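{- Let $\sigma$ be an injective substitution. Then: (1) If $E$ is a term or a quantifier-free formula such that $\mathrm{dom}(\sigma)\cap\mathrm{var}(E)=\emptyset$, then $(E\sigma^{ -1})\sigma = E$. (2) If $F,G$ are quantifier-free formulas such that $F\models G$, then $F\sigma^{ -1}\models G\sigma^{ -1}$.
   Context: Formulas are first-order without equality. A substitution is a mapping from variables to terms that is the identity almost everywhere; $\mathrm{dom}(\sigma)=\{x\mid x\sigma\neq x\}$, $\mathrm{rng}(\sigma)=\{x\sigma\mid x\in\mathrm{dom}(\sigma)\}$; $\mathrm{var}(E)$ is the set of variables occurring in $E$. For a set $\mathcal T$ of terms, an occurrence of a member of $\mathcal T$ in $E$ is $\mathcal T$-maximal if it does not lie within an occurrence of another member of $\mathcal T$. For an injective substitution $\sigma$ and a term or formula $E$, the inverse application $E\sigma^{ -1}$ denotes $E$ with every $\mathrm{rng}(\sigma)$-maximal occurrence of a term $t\in\mathrm{rng}(\sigma)$ replaced by the variable that $\sigma$ maps to $t$. -}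

module Defs where

open import Data.Nat using (ℕ; _≤_)
import Data.Nat as ℕ
open import Data.Bool using (Bool; true; false; not; _∧_; _∨_)
open import Data.List using (List; []; _∷_; _++_; upTo; concatMap)
open import Data.List.Membership.Propositional using (_∈_)
open import Data.Maybe using (Maybe; just; nothing)
open import Data.Product using (_×_; _,_)
open import Relation.Nullary using (¬_; Dec; yes; no)
open import Relation.Binary.PropositionalEquality using (_≡_; refl; cong; cong₂)

-- A symbol is applied to a list of
-- arguments (a symbol used with different numbers of arguments is, in
-- effect, a family of distinct symbols of fixed arities).

data Term : Set where
  var : ℕ → Term
  fun : ℕ → List Term → Term

data QFFormula : Set where
  atom : ℕ → List Term → QFFormula
  ⊤ᶠ ⊥ᶠ : QFFormula
  ¬ᶠ_ : QFFormula → QFFormula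
  _∧ᶠ_ _∨ᶠ_ _⇒ᶠ_ : QFFormula → QFFormula → QFFormula

mutual
  _≟ₜ_ : (s t : Term) → Dec (s ≡ t)
  var x ≟ₜ var y with x ℕ.≟ y
  ... | yes refl = yes refl
  ... | no x≢y = no λ { refl → x≢y refl }
  var x ≟ₜ fun g us = no λ ()
  fun f ts ≟ₜ var y = no λ ()
  fun f ts ≟ₜ fun g us with f ℕ.≟ g | ts ≟ₗ us
  ... | yes refl | yes refl = yes refl
  ... | no f≢g | _ = no λ { refl → f≢g refl }
  ... | yes _ | no ts≢us = no λ { refl → ts≢us refl }

  _≟ₗ_ : (ss ts : List Term) → Dec (ss ≡ ts)
  [] ≟ₗ [] = yes refl
  [] ≟ₗ (_ ∷ _) = no λ ()
  (_ ∷ _) ≟ₗ [] = no λ ()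
  (s ∷ ss) ≟ₗ (t ∷ ts) with s ≟ₜ t | ss ≟ₗ ts
  ... | yes refl | yes refl = yes refl
  ... | no s≢t | _ = no λ { refl → s≢t refl }
  ... | yes _ | no ≢ = no λ { refl → ≢ refl }

mutual
  varsₜ : Term → List ℕ
  varsₜ (var x) = x ∷ []
  varsₜ (fun f ts) = varsₗ ts

  varsₗ : List Term → List ℕ
  varsₗ [] = []
  varsₗ (t ∷ ts) = varsₜ t ++ varsₗ ts

varsᶠ : QFFormula → List ℕ
varsᶠ (atom p ts) = varsₗ ts
varsᶠ ⊤ᶠ = []
varsᶠ ⊥ᶠ = []
varsᶠ (¬ᶠ F) = varsᶠ F
varsᶠ (F ∧ᶠ G) = varsᶠ F ++ varsᶠ G
varsᶠ (F ∨ᶠ G) = varsᶠ F ++ varsᶠ G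
varsᶠ (F ⇒ᶠ G) = varsᶠ F ++ varsᶠ G

record Subst : Set where
  field
    map     : ℕ → Term
    bound   : ℕ
    almostId : ∀ x → bound ≤ x → map x ≡ var x
open Subst public

_∈dom_ : ℕ → Subst → Set
x ∈dom σ = ¬ (map σ x ≡ var x)

data _∈rng_ (t : Term) (σ : Subst) : Set where
  inRng : ∀ x → x ∈dom σ → map σ x ≡ t → t ∈rng σ

InjectiveSubst : Subst → Set
InjectiveSubst σ = ∀ x y → x ∈dom σ → y ∈dom σ → map σ x ≡ map σ y → x ≡ y

mutual
  _·ₜ_ : Term → Subst → Term
  var x ·ₜ σ = map σ x
  fun f ts ·ₜ σ = fun f (ts ·ₗ σ)

  _·ₗ_ : List Term → Subst → List Term
  [] ·ₗ σ = []
  (t ∷ ts) ·ₗ σ = (t ·ₜ σ) ∷ (ts ·ₗ σ)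

_·ᶠ_ : QFFormula → Subst → QFFormula
atom p ts ·ᶠ σ = atom p (ts ·ₗ σ)
⊤ᶠ ·ᶠ σ = ⊤ᶠ
⊥ᶠ ·ᶠ σ = ⊥ᶠ
(¬ᶠ F) ·ᶠ σ = ¬ᶠ (F ·ᶠ σ)
(F ∧ᶠ G) ·ᶠ σ = (F ·ᶠ σ) ∧ᶠ (G ·ᶠ σ)
(F ∨ᶠ G) ·ᶠ σ = (F ·ᶠ σ) ∨ᶠ (G ·ᶠ σ)
(F ⇒ᶠ G) ·ᶠ σ = (F ·ᶠ σ) ⇒ᶠ (G ·ᶠ σ)

-- Inverse application.  `preimage σ t` searches dom(σ) (all of which
-- lies below `bound σ`) for a variable x with xσ = t; for an injective
-- σ it is the unique such variable when t ∈ rng(σ).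

searchPre : (ℕ → Term) → Term → List ℕ → Maybe ℕ
searchPre m t [] = nothing
searchPre m t (x ∷ xs) with m x ≟ₜ var x
... | yes _ = searchPre m t xs
... | no _ with m x ≟ₜ t
...   | yes _ = just x
...   | no _ = searchPre m t xs

preimage : Subst → Term → Maybe ℕ
preimage σ t = searchPre (map σ) t (upTo (bound σ))

-- E σ⁻¹ : replace every rng(σ)-maximal occurrence of t ∈ rng(σ) by the
-- variable σ maps to t (top-down: an occurrence is replaced as soon as
-- it is a member of rng(σ), so only maximal occurrences are replaced).
mutual
  _·ₜ⁻¹_ : Term → Subst → Term
  var y ·ₜ⁻¹ σ with preimage σ (var y)
  ... | just x = var x
  ... | nothing = var y
  fun f ts ·ₜ⁻¹ σ with preimage σ (fun f ts)
  ... | just x = var x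
  ... | nothing = fun f (ts ·ₗ⁻¹ σ)

  _·ₗ⁻¹_ : List Term → Subst → List Term
  [] ·ₗ⁻¹ σ = []
  (t ∷ ts) ·ₗ⁻¹ σ = (t ·ₜ⁻¹ σ) ∷ (ts ·ₗ⁻¹ σ)

_·ᶠ⁻¹_ : QFFormula → Subst → QFFormula
atom p ts ·ᶠ⁻¹ σ = atom p (ts ·ₗ⁻¹ σ)
⊤ᶠ ·ᶠ⁻¹ σ = ⊤ᶠ
⊥ᶠ ·ᶠ⁻¹ σ = ⊥ᶠ
(¬ᶠ F) ·ᶠ⁻¹ σ = ¬ᶠ (F ·ᶠ⁻¹ σ)
(F ∧ᶠ G) ·ᶠ⁻¹ σ = (F ·ᶠ⁻¹ σ) ∧ᶠ (G ·ᶠ⁻¹ σ)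
(F ∨ᶠ G) ·ᶠ⁻¹ σ = (F ·ᶠ⁻¹ σ) ∨ᶠ (G ·ᶠ⁻¹ σ)
(F ⇒ᶠ G) ·ᶠ⁻¹ σ = (F ·ᶠ⁻¹ σ) ⇒ᶠ (G ·ᶠ⁻¹ σ)

record Interpretation (D : Set) : Set where
  field
    funᴵ  : ℕ → List D → D
    predᴵ : ℕ → List D → Bool
open Interpretation public

mutual
  evalₜ : {D : Set} → Interpretation D → (ℕ → D) → Term → D
  evalₜ I a (var x) = a x
  evalₜ I a (fun f ts) = funᴵ I f (evalₗ I a ts)

  evalₗ : {D : Set} → Interpretation D → (ℕ → D) → List Term → List D
  evalₗ I a [] = []
  evalₗ I a (t ∷ ts) = evalₜ I a t ∷ evalₗ I a ts

evalᶠ : {D : Set} → Interpretation D → (ℕ → D) → QFFormula → Bool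
evalᶠ I a (atom p ts) = predᴵ I p (evalₗ I a ts)
evalᶠ I a ⊤ᶠ = true
evalᶠ I a ⊥ᶠ = false
evalᶠ I a (¬ᶠ F) = not (evalᶠ I a F)
evalᶠ I a (F ∧ᶠ G) = evalᶠ I a F ∧ evalᶠ I a G
evalᶠ I a (F ∨ᶠ G) = evalᶠ I a F ∨ evalᶠ I a G
evalᶠ I a (F ⇒ᶠ G) = not (evalᶠ I a F) ∨ evalᶠ I a G

-- F ⊨ G : every interpretation with variable assignment that satisfies F
-- satisfies G.  (The domain is nonempty since an assignment ℕ → D exists.)
_⊨_ : QFFormula → QFFormula → Set₁
F ⊨ G = ∀ (D : Set) (I : Interpretation D) (a : ℕ → D) →
          evalᶠ I a F ≡ true → evalᶠ I a G ≡ true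

-- Part (1): whenever σ⁻¹ replaces a term by a variable x, the preimage search
-- guarantees xσ is that very term; every other variable is left alone and,
-- lying outside dom(σ), is fixed by σ.  Part (2): σ⁻¹ only rewrites the
-- argument lists of atoms, and any such uniform rewriting ρ preserves
-- entailment: a countermodel of ρF ⊨ ρG yields one of F ⊨ G in the term model
-- whose predicates hold of ts exactly when the original ones hold of ρ ts.
module Submission where

open import Defs
open import Data.Bool using (Bool; not; _∧_; _∨_)
open import Data.Product using (_×_; _,_)
open import Data.List using (List; []; _∷_; _++_; upTo)
open import Data.List.Membership.Propositional using (_∈_)
open import Data.List.Membership.Propositional.Properties using (∈-++⁺ˡ; ∈-++⁺ʳ)
open import Data.List.Relation.Unary.Any using (here)
open import Data.Maybe using (just; nothing)
open import Data.Nat using (ℕ)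
open import Data.Empty using (⊥-elim)
open import Relation.Nullary using (¬_; yes; no)
open import Relation.Binary.PropositionalEquality
  using (_≡_; refl; cong; cong₂; sym; trans; subst₂)

searchPre-sound : ∀ m t xs {x} → searchPre m t xs ≡ just x → m x ≡ t
searchPre-sound m t [] ()
searchPre-sound m t (y ∷ xs) eq with m y ≟ₜ var y
... | yes _ = searchPre-sound m t xs eq
... | no _ with m y ≟ₜ t
...   | yes my≡t with refl ← eq = my≡t
...   | no _ = searchPre-sound m t xs eq

preimage-sound : ∀ σ t {x} → preimage σ t ≡ just x → map σ x ≡ t
preimage-sound σ t = searchPre-sound (map σ) t (upTo (bound σ))

Avoids : Subst → List ℕ → Set
Avoids σ xs = ∀ x → x ∈ xs → ¬ (x ∈dom σ)

module _ (σ : Subst) where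

  avoids-++ˡ : ∀ xs {ys} → Avoids σ (xs ++ ys) → Avoids σ xs
  avoids-++ˡ xs h x x∈xs = h x (∈-++⁺ˡ x∈xs)

  avoids-++ʳ : ∀ xs {ys} → Avoids σ (xs ++ ys) → Avoids σ ys
  avoids-++ʳ xs h x x∈ys = h x (∈-++⁺ʳ xs x∈ys)

  mutual
    ·ₜ⁻¹-·ₜ : ∀ t → Avoids σ (varsₜ t) → (t ·ₜ⁻¹ σ) ·ₜ σ ≡ t
    ·ₜ⁻¹-·ₜ (var y) h with preimage σ (var y) in eq
    ... | just x = preimage-sound σ (var y) eq
    ... | nothing with map σ y ≟ₜ var y
    ...   | yes σy≡y = σy≡y
    ...   | no y∈dom = ⊥-elim (h y (here refl) y∈dom)
    ·ₜ⁻¹-·ₜ (fun f ts) h with preimage σ (fun f ts) in eq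
    ... | just x = preimage-sound σ (fun f ts) eq
    ... | nothing = cong (fun f) (·ₗ⁻¹-·ₗ ts h)

    ·ₗ⁻¹-·ₗ : ∀ ts → Avoids σ (varsₗ ts) → (ts ·ₗ⁻¹ σ) ·ₗ σ ≡ ts
    ·ₗ⁻¹-·ₗ [] h = refl
    ·ₗ⁻¹-·ₗ (t ∷ ts) h =
      cong₂ _∷_ (·ₜ⁻¹-·ₜ t (avoids-++ˡ (varsₜ t) h))
                (·ₗ⁻¹-·ₗ ts (avoids-++ʳ (varsₜ t) h))

  ·ᶠ⁻¹-·ᶠ : ∀ F → Avoids σ (varsᶠ F) → (F ·ᶠ⁻¹ σ) ·ᶠ σ ≡ F
  ·ᶠ⁻¹-·ᶠ (atom p ts) h = cong (atom p) (·ₗ⁻¹-·ₗ ts h)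
  ·ᶠ⁻¹-·ᶠ ⊤ᶠ h = refl
  ·ᶠ⁻¹-·ᶠ ⊥ᶠ h = refl
  ·ᶠ⁻¹-·ᶠ (¬ᶠ F) h = cong ¬ᶠ_ (·ᶠ⁻¹-·ᶠ F h)
  ·ᶠ⁻¹-·ᶠ (F ∧ᶠ G) h = cong₂ _∧ᶠ_ (·ᶠ⁻¹-·ᶠ F (avoids-++ˡ (varsᶠ F) h))
                                  (·ᶠ⁻¹-·ᶠ G (avoids-++ʳ (varsᶠ F) h))
  ·ᶠ⁻¹-·ᶠ (F ∨ᶠ G) h = cong₂ _∨ᶠ_ (·ᶠ⁻¹-·ᶠ F (avoids-++ˡ (varsᶠ F) h))
                                  (·ᶠ⁻¹-·ᶠ G (avoids-++ʳ (varsᶠ F) h))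
  ·ᶠ⁻¹-·ᶠ (F ⇒ᶠ G) h = cong₂ _⇒ᶠ_ (·ᶠ⁻¹-·ᶠ F (avoids-++ˡ (varsᶠ F) h))
                                  (·ᶠ⁻¹-·ᶠ G (avoids-++ʳ (varsᶠ F) h))

mapArgs : (List Term → List Term) → QFFormula → QFFormula
mapArgs ρ (atom p ts) = atom p (ρ ts)
mapArgs ρ ⊤ᶠ = ⊤ᶠ
mapArgs ρ ⊥ᶠ = ⊥ᶠ
mapArgs ρ (¬ᶠ F) = ¬ᶠ mapArgs ρ F
mapArgs ρ (F ∧ᶠ G) = mapArgs ρ F ∧ᶠ mapArgs ρ G
mapArgs ρ (F ∨ᶠ G) = mapArgs ρ F ∨ᶠ mapArgs ρ G
mapArgs ρ (F ⇒ᶠ G) = mapArgs ρ F ⇒ᶠ mapArgs ρ G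

·ᶠ⁻¹-mapArgs : ∀ σ F → F ·ᶠ⁻¹ σ ≡ mapArgs (_·ₗ⁻¹ σ) F
·ᶠ⁻¹-mapArgs σ (atom p ts) = refl
·ᶠ⁻¹-mapArgs σ ⊤ᶠ = refl
·ᶠ⁻¹-mapArgs σ ⊥ᶠ = refl
·ᶠ⁻¹-mapArgs σ (¬ᶠ F) = cong ¬ᶠ_ (·ᶠ⁻¹-mapArgs σ F)
·ᶠ⁻¹-mapArgs σ (F ∧ᶠ G) = cong₂ _∧ᶠ_ (·ᶠ⁻¹-mapArgs σ F) (·ᶠ⁻¹-mapArgs σ G)
·ᶠ⁻¹-mapArgs σ (F ∨ᶠ G) = cong₂ _∨ᶠ_ (·ᶠ⁻¹-mapArgs σ F) (·ᶠ⁻¹-mapArgs σ G)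
·ᶠ⁻¹-mapArgs σ (F ⇒ᶠ G) = cong₂ _⇒ᶠ_ (·ᶠ⁻¹-mapArgs σ F) (·ᶠ⁻¹-mapArgs σ G)

termModel : (ℕ → List Term → Bool) → Interpretation Term
termModel P = record { funᴵ = fun ; predᴵ = P }

mutual
  evalₜ-termModel-var : ∀ P t → evalₜ (termModel P) var t ≡ t
  evalₜ-termModel-var P (var x) = refl
  evalₜ-termModel-var P (fun f ts) = cong (fun f) (evalₗ-termModel-var P ts)

  evalₗ-termModel-var : ∀ P ts → evalₗ (termModel P) var ts ≡ ts
  evalₗ-termModel-var P [] = refl
  evalₗ-termModel-var P (t ∷ ts) =
    cong₂ _∷_ (evalₜ-termModel-var P t) (evalₗ-termModel-var P ts)

module _ {D : Set} (I : Interpretation D) (a : ℕ → D) (ρ : List Term → List Term) where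

  pullbackModel : Interpretation Term
  pullbackModel = termModel (λ p ts → predᴵ I p (evalₗ I a (ρ ts)))

  evalᶠ-pullbackModel : ∀ F → evalᶠ pullbackModel var F ≡ evalᶠ I a (mapArgs ρ F)
  evalᶠ-pullbackModel (atom p ts) =
    cong (λ us → predᴵ I p (evalₗ I a (ρ us))) (evalₗ-termModel-var _ ts)
  evalᶠ-pullbackModel ⊤ᶠ = refl
  evalᶠ-pullbackModel ⊥ᶠ = refl
  evalᶠ-pullbackModel (¬ᶠ F) = cong not (evalᶠ-pullbackModel F)
  evalᶠ-pullbackModel (F ∧ᶠ G) =
    cong₂ _∧_ (evalᶠ-pullbackModel F) (evalᶠ-pullbackModel G)
  evalᶠ-pullbackModel (F ∨ᶠ G) =
    cong₂ _∨_ (evalᶠ-pullbackModel F) (evalᶠ-pullbackModel G)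
  evalᶠ-pullbackModel (F ⇒ᶠ G) =
    cong₂ (λ b c → not b ∨ c)
          (evalᶠ-pullbackModel F) (evalᶠ-pullbackModel G)

⊨-mapArgs : ∀ ρ F G → F ⊨ G → mapArgs ρ F ⊨ mapArgs ρ G
⊨-mapArgs ρ F G F⊨G D I a ⟦ρF⟧ =
  trans (sym (evalᶠ-pullbackModel I a ρ G))
        (F⊨G Term (pullbackModel I a ρ) var
             (trans (evalᶠ-pullbackModel I a ρ F) ⟦ρF⟧))

⊨-·ᶠ⁻¹ : ∀ σ F G → F ⊨ G → (F ·ᶠ⁻¹ σ) ⊨ (G ·ᶠ⁻¹ σ)
⊨-·ᶠ⁻¹ σ F G F⊨G =
  subst₂ _⊨_ (sym (·ᶠ⁻¹-mapArgs σ F)) (sym (·ᶠ⁻¹-mapArgs σ G))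
         (⊨-mapArgs (_·ₗ⁻¹ σ) F G F⊨G)

proposition2 : (σ : Subst) → InjectiveSubst σ →
    ( (∀ (t : Term) → (∀ x → x ∈ varsₜ t → ¬ (x ∈dom σ)) →
          ((t ·ₜ⁻¹ σ) ·ₜ σ) ≡ t)
    × (∀ (F : QFFormula) → (∀ x → x ∈ varsᶠ F → ¬ (x ∈dom σ)) →
          ((F ·ᶠ⁻¹ σ) ·ᶠ σ) ≡ F) )
  × (∀ (F G : QFFormula) → F ⊨ G → (F ·ᶠ⁻¹ σ) ⊨ (G ·ᶠ⁻¹ σ))
proposition2 σ _ = (·ₜ⁻¹-·ₜ σ , ·ᶠ⁻¹-·ᶠ σ) , ⊨-·ᶠ⁻¹ σ
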